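{- Let $X$ be a fragment of a Berge trigraph $T$. If the block of decomposition $T_X$ has an even pair $\{u,v\}$ disjoint from its marker component, then $\{u,v\}$ is also an even pair in $T$.
   Context: A trigraph $T$ consists of a finite set $V(T)$ and a map $\theta:\binom{V(T)}{2}\to\{ -1,0,1\}$. Distinct $u,v$ are strongly adjacent if $\theta(uv)=1$, strongly antiadjacent if $\theta(uv)=-1$, semiadjacent (a switchable pair) if $\theta(uv)=0$; adjacent if $\theta(uv)\in\{0,1\}$, antiadjacent if $\theta(uv)\in\{0,-1\}$. $T|X$ is the restriction to $X$. $A$ is strongly complete to $B$ if every vertex of $A$ is strongly adjacent to every vertex of $B$. The full realization is the graph whose edges are the adjacent pairs. A path is a sequence $p_1,\dots,p_k$ of distinct vertices with $p_i,p_j$ adjacent when $|i-j|=1$ and antiadjacent when $|i-j|>1$; length $k-1$. A hole is a sequence $h_1,\dots,h_k$ ($k\ge5$) with cyclically consecutive vertices adjacent and other pairs antiadjacent; an antihole is an induced subtrigraph whose complement (adjacency $-\theta$) is a hole. $T$ is Berge if it has no odd hole and no odd antihole. An even pair is a strongly antiadjacent pair $\{u,v\}$ such that every path from $u$ to $v$ has even length. A 2-join is a partition $(X_1,X_2)$ of $V(T)$ with disjoint sets $A_1,B_1,C_1,A_2,B_2,C_2$ (a split), $X_i=A_i\cup B_i\cup C_i$, such that $A_1,A_2,B_1,B_2$ are nonempty; no switchable pair is between $X_1$ and $X_2$; $A_1$ is strongly complete to $A_2$, $B_1$ is strongly complete to $B_2$, and there are no other strong edges between $X_1$ and $X_2$;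 $|X_i|\ge3$; and if $|A_i|=|B_i|=1$, the full realization of $T|X_i$ is not a path of length two containing the members of $A_i$ and $B_i$. It is proper if every component of $T|X_i$ (maximal subset connected in the graph of adjacent pairs) meets both $A_i$ and $B_i$, $i=1,2$. For a Berge trigraph and a proper 2-join, all paths with one end in $A_i$, one end in $B_i$ and interior in $C_i$ ($i=1,2$) have lengths of the same parity; the 2-join is even or odd accordingly. $X$ is a fragment of $T$ if $(X,V(T)\setminus X)$ is a proper 2-join. The block of decomposition $T_X$ (with $X_1=X$): if the 2-join is odd, $T_X$ is obtained from $T|X_1$ by adding marker vertices $a,b$ with $a$ strongly complete to $A_1$, $b$ strongly complete to $B_1$, $ab$ a switchable pair, and all other pairs between $\{a,b\}$ and $X_1$ strongly antiadjacent; if it is even, add marker vertices $a,b,c$ with $a$ strongly complete to $A_1$, $b$ strongly complete to $B_1$, $ac$ and $bc$ switchable pairs, and all other pairs among $\{a,b,c\}$ and between $\{a,b,c\}$ and $X_1$ strongly antiadjacent. The added vertices form the marker component; $\{u,v\}$ is disjoint from it if $u,v\in X_1$. -}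

module Defs where

open import Data.Nat using (ℕ; zero; suc; _<_; _≥_; _∸_)
open import Data.Fin using (Fin; toℕ; fromℕ) renaming (zero to fzero; suc to fsuc)
open import Data.Bool using (Bool; true; false; not)
open import Data.Product using (Σ; ∃; _×_; _,_; ∃-syntax)
open import Data.Sum using (_⊎_; inj₁; inj₂)
open import Relation.Nullary using (¬_)
open import Relation.Binary.PropositionalEquality using (_≡_; _≢_; refl)

parity : ℕ → Bool
parity zero    = false
parity (suc n) = not (parity n)

-- Trigraphs.  theta u v : strong = 1, semi = 0 (switchable), anti = -1.
-- theta is a symmetric function on ordered pairs (= a function on
-- unordered pairs); its value on the diagonal is irrelevant and never used.

data Adj : Set where
  strong semi anti : Adj

negAdj : Adj → Adj
negAdj strong = anti
negAdj semi   = semi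
negAdj anti   = strong

record Trigraph (V : Set) : Set where
  field
    θ     : V → V → Adj
    θ-sym : ∀ u v → θ u v ≡ θ v u
open Trigraph public

complement : {V : Set} → Trigraph V → Trigraph V
complement T = record { θ = λ u v → negAdj (θ T u v)
                      ; θ-sym = λ u v → cong′ (θ-sym T u v) }
  where
  cong′ : ∀ {x y} → x ≡ y → negAdj x ≡ negAdj y
  cong′ refl = refl

module _ {V : Set} (T : Trigraph V) where

  Adjacent : V → V → Set
  Adjacent u v = θ T u v ≢ anti

  Antiadjacent : V → V → Set
  Antiadjacent u v = θ T u v ≢ strong

  record PathOfLength (k : ℕ) (u v : V) : Set where
    field
      vert   : Fin (suc k) → V
      inj    : ∀ i j → vert i ≡ vert j → i ≡ j
      start  : vert fzero ≡ u
      end    : vert (fromℕ k) ≡ v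
      consec : ∀ i j → toℕ j ≡ suc (toℕ i) → Adjacent (vert i) (vert j)
      nonc   : ∀ i j → suc (toℕ i) < toℕ j → Antiadjacent (vert i) (vert j)
  open PathOfLength public

  CycConsec : (k : ℕ) → Fin k → Fin k → Set
  CycConsec k i j = (toℕ j ≡ suc (toℕ i)) ⊎ ((toℕ i ≡ k ∸ 1) × (toℕ j ≡ 0))

  IsHole : (k : ℕ) → (Fin k → V) → Set
  IsHole k h =
    (k ≥ 5)
    × (∀ i j → h i ≡ h j → i ≡ j)
    × (∀ i j → CycConsec k i j → Adjacent (h i) (h j))
    × (∀ i j → i ≢ j → ¬ CycConsec k i j → ¬ CycConsec k j i →
         Antiadjacent (h i) (h j))

  HasOddHole : Set
  HasOddHole = Σ ℕ λ k → Σ (Fin k → V) λ h → IsHole k h × (parity k ≡ true)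

  EvenPair : V → V → Set
  EvenPair u v =
    (u ≢ v) × (θ T u v ≡ anti) ×
    (∀ k → PathOfLength k u v → parity k ≡ false)

HasOddAntihole : {V : Set} → Trigraph V → Set
HasOddAntihole T = HasOddHole (complement T)

Berge : {V : Set} → Trigraph V → Set
Berge T = ¬ HasOddHole T × ¬ HasOddAntihole T

-- Splits: a labelling of each vertex by one of A1,B1,C1,A2,B2,C2.

data Lab : Set where
  a₁ b₁ c₁ a₂ b₂ c₂ : Lab

data Side : Set where
  one two : Side

side : Lab → Side
side a₁ = one
side b₁ = one
side c₁ = one
side a₂ = two
side b₂ = two
side c₂ = two

aOf bOf cOf : Side → Lab
aOf one = a₁
aOf two = a₂
bOf one = b₁
bOf two = b₂
cOf one = c₁
cOf two = c₂

module _ {V : Set} (T : Trigraph V) (s : V → Lab) where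

  InSide : Side → V → Set
  InSide i v = side (s v) ≡ i

  Singleton : Lab → Set
  Singleton l = Σ V λ x → ∀ w → (s w ≡ l → w ≡ x) × (w ≡ x → s w ≡ l)

  RealizationP3 : Side → Set
  RealizationP3 i =
    Σ V λ x → Σ V λ y → Σ V λ z →
      (x ≢ y) × (y ≢ z) × (x ≢ z) ×
      InSide i x × InSide i y × InSide i z ×
      (∀ w → InSide i w → (w ≡ x) ⊎ (w ≡ y) ⊎ (w ≡ z)) ×
      Adjacent T x y × Adjacent T y z × (θ T x z ≡ anti)

  AtLeast3 : Side → Set
  AtLeast3 i =
    Σ V λ x → Σ V λ y → Σ V λ z →
      (x ≢ y) × (y ≢ z) × (x ≢ z) × InSide i x × InSide i y × InSide i z

  record IsTwoJoin : Set where
    field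
      A₁-ne : ∃ λ v → s v ≡ a₁
      A₂-ne : ∃ λ v → s v ≡ a₂
      B₁-ne : ∃ λ v → s v ≡ b₁
      B₂-ne : ∃ λ v → s v ≡ b₂
      no-switch : ∀ u v → InSide one u → InSide two v → θ T u v ≢ semi
      AA : ∀ u v → s u ≡ a₁ → s v ≡ a₂ → θ T u v ≡ strong
      BB : ∀ u v → s u ≡ b₁ → s v ≡ b₂ → θ T u v ≡ strong
      no-other : ∀ u v → InSide one u → InSide two v → θ T u v ≡ strong →
                 ((s u ≡ a₁) × (s v ≡ a₂)) ⊎ ((s u ≡ b₁) × (s v ≡ b₂))
      size : ∀ i → AtLeast3 i
      not-P3 : ∀ i → Singleton (aOf i) → Singleton (bOf i) → ¬ RealizationP3 i

  data Conn (i : Side) : V → V → Set where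
    here : ∀ {x} → Conn i x x
    step : ∀ {x y z} → InSide i y → Adjacent T x y → Conn i y z → Conn i x z

  IsProper : Set
  IsProper = ∀ i x → InSide i x →
    (Σ V λ a → (s a ≡ aOf i) × Conn i x a) ×
    (Σ V λ b → (s b ≡ bOf i) × Conn i x b)

  TwoJoinParity : Bool → Set
  TwoJoinParity p = ∀ i k a b → s a ≡ aOf i → s b ≡ bOf i →
    (P : PathOfLength T k a b) →
    (∀ j → 0 < toℕ j → toℕ j < k → s (vert P j) ≡ cOf i) →
    parity k ≡ p

-- Block of decomposition T_X for X = X_1.
-- Marker true  (odd 2-join):  markers a, b
-- Marker false (even 2-join): markers a, b, c

data Marker : Bool → Set where
  ma mb : ∀ {p} → Marker p
  mc    : Marker false

markerAdj : ∀ {p} → Lab → Marker p → Adj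
markerAdj a₁ ma = strong
markerAdj b₁ mb = strong
markerAdj _  _  = anti

mm : ∀ {p} → Marker p → Marker p → Adj
mm {true}  ma mb = semi
mm {true}  mb ma = semi
mm {false} ma mc = semi
mm {false} mc ma = semi
mm {false} mb mc = semi
mm {false} mc mb = semi
mm _ _ = anti

mm-sym : ∀ {p} (m m' : Marker p) → mm m m' ≡ mm m' m
mm-sym {true}  ma ma = refl
mm-sym {true}  ma mb = refl
mm-sym {true}  mb ma = refl
mm-sym {true}  mb mb = refl
mm-sym {false} ma ma = refl
mm-sym {false} ma mb = refl
mm-sym {false} ma mc = refl
mm-sym {false} mb ma = refl
mm-sym {false} mb mb = refl
mm-sym {false} mb mc = refl
mm-sym {false} mc ma = refl
mm-sym {false} mc mb = refl
mm-sym {false} mc mc = refl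

module _ {V : Set} (T : Trigraph V) (s : V → Lab) (p : Bool) where

  BlockV : Set
  BlockV = Σ V (λ v → side (s v) ≡ one) ⊎ Marker p

  blockθ : BlockV → BlockV → Adj
  blockθ (inj₁ (x , _)) (inj₁ (y , _)) = θ T x y
  blockθ (inj₁ (x , _)) (inj₂ m)       = markerAdj (s x) m
  blockθ (inj₂ m)       (inj₁ (x , _)) = markerAdj (s x) m
  blockθ (inj₂ m)       (inj₂ m')      = mm m m'

  blockθ-sym : ∀ u v → blockθ u v ≡ blockθ v u
  blockθ-sym (inj₁ (x , _)) (inj₁ (y , _)) = θ-sym T x y
  blockθ-sym (inj₁ _) (inj₂ _) = refl
  blockθ-sym (inj₂ _) (inj₁ _) = refl
  blockθ-sym (inj₂ m) (inj₂ m') = mm-sym m m'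

  Block : Trigraph BlockV
  Block = record { θ = blockθ ; θ-sym = blockθ-sym }

-- Let P be a path of T between u, v ∈ X₁. The only edges between the two sides are the
-- strong edges A₁A₂ and B₁B₂, and P is induced, so P meets A₂ and B₂ in at most one vertex
-- each; hence the C₂-vertices of P form a single subpath running from A₂ to B₂ through C₂,
-- whose length has the parity of the 2-join. Sending A₂, B₂, C₂ to the markers a, b, c and
-- cutting that subpath down to a–b (odd 2-join) or a–c–b (even 2-join) removes an even
-- number of vertices and leaves a path of T_X from u to v, whose length is even.

{-# OPTIONS --safe #-}
module Submission where

open import Defs
open import Data.Nat using (ℕ; zero; suc; _+_; _∸_; _≤_; _<_; z≤n; s≤s; s≤s⁻¹; _≤?_; _≟_)
open import Data.Nat.Properties
open import Data.Fin using (Fin; toℕ; fromℕ; fromℕ<) renaming (zero to fzero)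
open import Data.Fin.Properties using (toℕ-injective; toℕ<n; toℕ-fromℕ; toℕ-fromℕ<)
open import Data.Bool using (Bool; true; false; not; _xor_)
open import Data.Bool.Properties using (not-involutive; ¬-not; not-distribˡ-xor) renaming (_≟_ to _≟ᵇ_)
open import Data.Product using (Σ; _×_; _,_; proj₁; proj₂)
open import Data.Sum using (_⊎_; inj₁; inj₂)
open import Data.Sum.Properties using (inj₁-injective; inj₂-injective)
open import Data.Empty using (⊥; ⊥-elim)
open import Function using (_∘_)
open import Axiom.UniquenessOfIdentityProofs.WithK using (uip)
open import Relation.Nullary using (¬_; yes; no; contradiction)
open import Relation.Binary.Definitions using (DecidableEquality; tri<; tri≈; tri>)
open import Relation.Binary.PropositionalEquality

-- Paths as sequences indexed by ℕ

module _ {W : Set} (T : Trigraph W) where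

  adjacent-sym : ∀ {x y} → Adjacent T x y → Adjacent T y x
  adjacent-sym {x} {y} a e = a (trans (θ-sym T x y) e)

  antiadjacent-sym : ∀ {x y} → Antiadjacent T x y → Antiadjacent T y x
  antiadjacent-sym {x} {y} a e = a (trans (θ-sym T x y) e)

  strong⇒adjacent : ∀ {x y} → θ T x y ≡ strong → Adjacent T x y
  strong⇒adjacent e e′ with () ← trans (sym e) e′

  semi⇒adjacent : ∀ {x y} → θ T x y ≡ semi → Adjacent T x y
  semi⇒adjacent e e′ with () ← trans (sym e) e′

  anti⇒antiadjacent : ∀ {x y} → θ T x y ≡ anti → Antiadjacent T x y
  anti⇒antiadjacent e e′ with () ← trans (sym e) e′

  record IsPathSeq (w : ℕ → W) (k : ℕ) : Set where
    field
      adjacent     : ∀ m → m < k → Adjacent T (w m) (w (suc m))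
      antiadjacent : ∀ m m' → 2 + m ≤ m' → m' ≤ k → Antiadjacent T (w m) (w m')
      injective    : ∀ m m' → m ≤ k → m' ≤ k → w m ≡ w m' → m ≡ m'
  open IsPathSeq public

  toPathOfLength : ∀ {w k} → IsPathSeq w k → PathOfLength T k (w 0) (w k)
  toPathOfLength {w} {k} P = record
    { vert   = λ i → w (toℕ i)
    ; inj    = λ i j e → toℕ-injective (injective P _ _ (toℕ≤ i) (toℕ≤ j) e)
    ; start  = refl
    ; end    = cong w (toℕ-fromℕ k)
    ; consec = λ i j e → subst (λ m → Adjacent T (w (toℕ i)) (w m)) (sym e)
                 (adjacent P (toℕ i) (subst (_≤ k) e (toℕ≤ j)))
    ; nonc   = λ i j lt → antiadjacent P (toℕ i) (toℕ j) lt (toℕ≤ j)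
    }
    where
    toℕ≤ : (i : Fin (suc k)) → toℕ i ≤ k
    toℕ≤ i = s≤s⁻¹ (toℕ<n i)

  -- Indices beyond k are sent to k; only the values at m ≤ k matter.
  clampFin : (k m : ℕ) → Fin (suc k)
  clampFin k m with m ≤? k
  ... | yes m≤k = fromℕ< (s≤s m≤k)
  ... | no  _   = fromℕ k

  toℕ-clampFin : ∀ {k m} → m ≤ k → toℕ (clampFin k m) ≡ m
  toℕ-clampFin {k} {m} m≤k with m ≤? k
  ... | yes p = toℕ-fromℕ< (s≤s p)
  ... | no ¬p = contradiction m≤k ¬p

  fromPathOfLength : ∀ {k x y} → PathOfLength T k x y →
    Σ (ℕ → W) λ w → IsPathSeq w k × w 0 ≡ x × w k ≡ y
  fromPathOfLength {k} P = w , seq , trans (vertAt z≤n fzero refl) (start P)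
                                   , trans (vertAt ≤-refl (fromℕ k) (toℕ-fromℕ k)) (end P)
    where
    w : ℕ → W
    w m = vert P (clampFin k m)

    vertAt : ∀ {m} → m ≤ k → (i : Fin (suc k)) → toℕ i ≡ m → w m ≡ vert P i
    vertAt m≤k i e = cong (vert P) (toℕ-injective (trans (toℕ-clampFin m≤k) (sym e)))

    seq : IsPathSeq w k
    seq = record
      { adjacent     = λ m m<k → consec P _ _
          (trans (toℕ-clampFin m<k) (cong suc (sym (toℕ-clampFin (<⇒≤ m<k)))))
      ; antiadjacent = λ m m' lt m'≤k → nonc P _ _
          (subst₂ (λ a b → suc a < b)
            (sym (toℕ-clampFin (≤-trans (m≤n+m m 2) (≤-trans lt m'≤k))))
            (sym (toℕ-clampFin m'≤k)) lt)
      ; injective    = λ m m' m≤k m'≤k e → trans (sym (toℕ-clampFin m≤k))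
          (trans (cong toℕ (PathOfLength.inj P _ _ e)) (toℕ-clampFin m'≤k))
      }

  restrict : ∀ {w k} i L → i + L ≤ k → IsPathSeq w k → IsPathSeq (λ m → w (i + m)) L
  restrict {w} {k} i L i+L≤k P = record
    { adjacent     = λ m m<L → subst (λ j → Adjacent T (w (i + m)) (w j)) (sym (+-suc i m))
        (adjacent P (i + m) (≤-trans (≤-reflexive (sym (+-suc i m))) (shift m<L)))
    ; antiadjacent = λ m m' lt m'≤L → antiadjacent P (i + m) (i + m')
        (≤-trans (≤-reflexive (sym (+-suc-suc i m))) (+-monoʳ-≤ i lt)) (shift m'≤L)
    ; injective    = λ m m' m≤L m'≤L e →
        +-cancelˡ-≡ i m m' (injective P _ _ (shift m≤L) (shift m'≤L) e)
    }
    where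
    shift : ∀ {m} → m ≤ L → i + m ≤ k
    shift m≤L = ≤-trans (+-monoʳ-≤ i m≤L) i+L≤k
    +-suc-suc : ∀ i m → i + suc (suc m) ≡ suc (suc (i + m))
    +-suc-suc i m = trans (+-suc i (suc m)) (cong suc (+-suc i m))

  reverse : ∀ {w k} → IsPathSeq w k → IsPathSeq (λ m → w (k ∸ m)) k
  reverse {w} {k} P = record
    { adjacent     = λ m m<k → adjacent-sym
        (subst (λ j → Adjacent T (w (k ∸ suc m)) (w j)) (sym (+-∸-assoc 1 m<k))
          (adjacent P (k ∸ suc m) (∸-monoʳ-< {o = 0} (s≤s z≤n) m<k)))
    ; antiadjacent = λ m m' lt m'≤k → antiadjacent-sym (antiadjacent P (k ∸ m') (k ∸ m)
        (≤-trans (≤-reflexive (sym (+-∸-assoc 2 m'≤k))) (∸-monoʳ-≤ (2 + k) lt))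
        (m∸n≤m k m))
    ; injective    = λ m m' m≤k m'≤k e →
        ∸-cancelˡ-≡ m≤k m'≤k (injective P _ _ (m∸n≤m k m) (m∸n≤m k m') e)
    }

module _ (q : ℕ → Bool) where

  private
    true≢false : ∀ {m m'} → q m ≡ true → q m' ≡ false → m ≢ m'
    true≢false qm qm' refl with () ← trans (sym qm) qm'

  lastTrueBelow : q 0 ≡ true → ∀ i → q i ≡ false →
    Σ ℕ λ t → t < i × q t ≡ true × (∀ m → t < m → m ≤ i → q m ≡ false)
  lastTrueBelow q0 zero qi = contradiction refl (true≢false q0 qi)
  lastTrueBelow q0 (suc i) qsi with q i in qi
  ... | true  = i , ≤-refl , qi , λ m i<m m≤si → subst (λ j → q j ≡ false) (≤-antisym i<m m≤si) qsi
  ... | false with lastTrueBelow q0 i qi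
  ...   | t , t<i , qt , gap = t , m≤n⇒m≤1+n t<i , qt , gap′
    where
    gap′ : ∀ m → t < m → m ≤ suc i → q m ≡ false
    gap′ m t<m m≤si with m≤n⇒m<n∨m≡n m≤si
    ... | inj₁ m<si = gap m t<m (s≤s⁻¹ m<si)
    ... | inj₂ refl = qsi

  firstTrueAbove : ∀ {k} → q k ≡ true → ∀ j → j ≤ k → q j ≡ false →
    Σ ℕ λ t → j < t × t ≤ k × q t ≡ true × (∀ m → j ≤ m → m < t → q m ≡ false)
  firstTrueAbove {k} qk j j≤k qj = search (k ∸ j) j (m+[n∸m]≡n j≤k) qj
    where
    search : ∀ g j → j + g ≡ k → q j ≡ false →
      Σ ℕ λ t → j < t × t ≤ k × q t ≡ true × (∀ m → j ≤ m → m < t → q m ≡ false)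
    search zero j j+0≡k qj = contradiction (trans (sym j+0≡k) (+-identityʳ j)) (true≢false qk qj)
    search (suc g) j j+g≡k qj with q (suc j) in qsj
    ... | true  = suc j , ≤-refl
                , ≤-trans (s≤s (m≤m+n j g)) (≤-reflexive (trans (sym (+-suc j g)) j+g≡k)) , qsj
                , λ m j≤m m<sj → subst (λ i → q i ≡ false) (≤-antisym j≤m (s≤s⁻¹ m<sj)) qj
    ... | false with search g (suc j) (trans (sym (+-suc j g)) j+g≡k) qsj
    ...   | t , sj<t , t≤k , qt , gap = t , <-trans (n<1+n j) sj<t , t≤k , qt , gap′
      where
      gap′ : ∀ m → j ≤ m → m < t → q m ≡ false
      gap′ m j≤m m<t with m≤n⇒m<n∨m≡n j≤m
      ... | inj₁ j<m = gap m j<m m<t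
      ... | inj₂ refl = qj

-- Deleting the window m₀+1, …, m₀+d from a path

module _ (m₀ d : ℕ) where

  OutsideWindow : ℕ → Set
  OutsideWindow Q = Q ≤ m₀ ⊎ m₀ + d < Q

  skipWindow : ℕ → ℕ
  skipWindow m with m ≤? m₀
  ... | yes _ = m
  ... | no  _ = m + d

  skipWindow-outside : ∀ m → OutsideWindow (skipWindow m)
  skipWindow-outside m with m ≤? m₀
  ... | yes m≤m₀ = inj₁ m≤m₀
  ... | no  m≰m₀ = inj₂ (+-monoˡ-< d (≰⇒> m≰m₀))

  skipWindow-zero : skipWindow 0 ≡ 0
  skipWindow-zero with 0 ≤? m₀
  ... | yes _ = refl
  ... | no 0≰m₀ = contradiction z≤n 0≰m₀

  skipWindow-≤ : ∀ {k m} → m₀ + d ≤ k → m ≤ k ∸ d → skipWindow m ≤ k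
  skipWindow-≤ {k} {m} m₀+d≤k m≤k-d with m ≤? m₀
  ... | yes _ = ≤-trans m≤k-d (m∸n≤m k d)
  ... | no  _ = ≤-trans (+-monoˡ-≤ d m≤k-d) (≤-reflexive (m∸n+n≡m (≤-trans (m≤n+m d m₀) m₀+d≤k)))

  skipWindow-last : ∀ {k} → m₀ + d ≤ k → d ≡ 0 ⊎ m₀ + d < k → skipWindow (k ∸ d) ≡ k
  skipWindow-last {k} m₀+d≤k last with k ∸ d ≤? m₀ | last
  ... | no  _        | _          = m∸n+n≡m (≤-trans (m≤n+m d m₀) m₀+d≤k)
  ... | yes _        | inj₁ refl  = refl
  ... | yes k-d≤m₀   | inj₂ m₀+d<k = contradiction k-d≤m₀
    (<⇒≱ (≤-trans (≤-reflexive (sym (m+n∸n≡m (suc m₀) d))) (∸-monoˡ-≤ d m₀+d<k)))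

  skipWindow-<-mono : ∀ {m m'} → m < m' → skipWindow m < skipWindow m'
  skipWindow-<-mono {m} {m'} m<m' with m ≤? m₀ | m' ≤? m₀
  ... | yes _   | yes _    = m<m'
  ... | yes _   | no  _    = ≤-trans m<m' (m≤m+n m' d)
  ... | no m≰m₀ | yes m'≤m₀ = contradiction (≤-trans (n≤1+n m) (≤-trans m<m' m'≤m₀)) m≰m₀
  ... | no  _   | no  _    = +-monoˡ-≤ d m<m'

  skipWindow-gap : ∀ {m m'} → 2 + m ≤ m' → 2 + skipWindow m ≤ skipWindow m'
  skipWindow-gap {m} {m'} lt with m ≤? m₀ | m' ≤? m₀
  ... | yes _   | yes _    = lt
  ... | yes _   | no  _    = ≤-trans lt (m≤m+n m' d)
  ... | no m≰m₀ | yes m'≤m₀ = contradiction (≤-trans (m≤n+m m 2) (≤-trans lt m'≤m₀)) m≰m₀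
  ... | no  _   | no  _    = +-monoˡ-≤ d lt

  skipWindow-injective : ∀ {m m'} → skipWindow m ≡ skipWindow m' → m ≡ m'
  skipWindow-injective {m} {m'} e with <-cmp m m'
  ... | tri< m<m' _ _ = contradiction e (<⇒≢ (skipWindow-<-mono m<m'))
  ... | tri≈ _ m≡m' _ = m≡m'
  ... | tri> _ _ m'<m = contradiction (sym e) (<⇒≢ (skipWindow-<-mono m'<m))

  skipWindow-suc : ∀ m → skipWindow (suc m) ≡ suc (skipWindow m)
                       ⊎ (skipWindow m ≡ m₀ × skipWindow (suc m) ≡ suc (m₀ + d) × 0 < d)
  skipWindow-suc m with m ≤? m₀ | suc m ≤? m₀
  ... | yes _     | yes _   = inj₁ refl
  ... | no m≰m₀   | yes sm≤m₀ = contradiction (≤-trans (n≤1+n m) sm≤m₀) m≰m₀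
  ... | no  _     | no  _   = inj₁ refl
  ... | yes m≤m₀  | no sm≰m₀ with d ≟ 0
  ...   | yes refl = inj₁ (cong suc (+-identityʳ m))
  ...   | no  d≢0  = inj₂ (m≡m₀ , cong (λ j → suc (j + d)) m≡m₀ , n≢0⇒n>0 d≢0)
    where
    m≡m₀ : m ≡ m₀
    m≡m₀ = ≤-antisym m≤m₀ (s≤s⁻¹ (≰⇒> sm≰m₀))

module _ {W : Set} (T : Trigraph W) (g : ℕ → W) {m₀ d k : ℕ} (m₀+d≤k : m₀ + d ≤ k)
  (consecutive : ∀ Q → Q < k → OutsideWindow m₀ d Q → OutsideWindow m₀ d (suc Q) →
                   Adjacent T (g Q) (g (suc Q)))
  (across : 0 < d → Adjacent T (g m₀) (g (suc (m₀ + d))))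
  (distant : ∀ Q Q' → OutsideWindow m₀ d Q → OutsideWindow m₀ d Q' → 2 + Q ≤ Q' → Q' ≤ k →
               Antiadjacent T (g Q) (g Q'))
  (injectiveOutside : ∀ Q Q' → OutsideWindow m₀ d Q → OutsideWindow m₀ d Q' → Q ≤ k → Q' ≤ k →
               g Q ≡ g Q' → Q ≡ Q')
  where

  deleteWindow : IsPathSeq T (g ∘ skipWindow m₀ d) (k ∸ d)
  deleteWindow = record
    { adjacent     = adj
    ; antiadjacent = λ m m' lt m'≤ →
        distant _ _ (out m) (out m') (skipWindow-gap m₀ d lt) (bound m'≤)
    ; injective    = λ m m' m≤ m'≤ e → skipWindow-injective m₀ d
        (injectiveOutside _ _ (out m) (out m') (bound m≤) (bound m'≤) e)
    }
    where
    h : ℕ → ℕ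
    h = skipWindow m₀ d
    out : ∀ m → OutsideWindow m₀ d (h m)
    out = skipWindow-outside m₀ d
    bound : ∀ {m} → m ≤ k ∸ d → h m ≤ k
    bound = skipWindow-≤ m₀ d m₀+d≤k

    adj : ∀ m → m < k ∸ d → Adjacent T (g (h m)) (g (h (suc m)))
    adj m m<k-d with skipWindow-suc m₀ d m
    ... | inj₁ e = subst (λ j → Adjacent T (g (h m)) (g j)) (sym e)
        (consecutive (h m) (subst (_≤ k) e (bound m<k-d))
          (out m) (subst (OutsideWindow m₀ d) e (out (suc m))))
    ... | inj₂ (e₀ , e₁ , 0<d) =
        subst₂ (λ i j → Adjacent T (g i) (g j)) (sym e₀) (sym e₁) (across 0<d)

-- Paths through a 2-join

data Pole : Set where
  A B : Pole

opposite : Pole → Pole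
opposite A = B
opposite B = A

≢⇒opposite : ∀ {α β} → β ≢ α → β ≡ opposite α
≢⇒opposite {A} {A} β≢α = contradiction refl β≢α
≢⇒opposite {A} {B} _   = refl
≢⇒opposite {B} {A} _   = refl
≢⇒opposite {B} {B} β≢α = contradiction refl β≢α

opposite-≢ : ∀ α → opposite α ≢ α
opposite-≢ A ()
opposite-≢ B ()

opposite-involutive : ∀ α → opposite (opposite α) ≡ α
opposite-involutive A = refl
opposite-involutive B = refl

_≟ᴾ_ : DecidableEquality Pole
A ≟ᴾ A = yes refl
A ≟ᴾ B = no λ ()
B ≟ᴾ A = no λ ()
B ≟ᴾ B = yes refl

lab₁ lab₂ : Pole → Lab
lab₁ A = a₁
lab₁ B = b₁
lab₂ A = a₂
lab₂ B = b₂

lab₂-injective : ∀ {α β} → lab₂ α ≡ lab₂ β → α ≡ β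
lab₂-injective {A} {A} _ = refl
lab₂-injective {B} {B} _ = refl

lab₂≢c₂ : ∀ α → lab₂ α ≢ c₂
lab₂≢c₂ A ()
lab₂≢c₂ B ()

pole-side : ∀ {l} α → l ≡ lab₂ α → side l ≡ two
pole-side A refl = refl
pole-side B refl = refl

isOne : Side → Bool
isOne one = true
isOne two = false

isOne-true : ∀ {i} → isOne i ≡ true → i ≡ one
isOne-true {one} _ = refl

isOne-false : ∀ {i} → isOne i ≡ false → i ≡ two
isOne-false {two} _ = refl

notC₂ : Lab → Bool
notC₂ c₂ = false
notC₂ _  = true

notC₂-false : ∀ {l} → notC₂ l ≡ false → l ≡ c₂
notC₂-false {c₂} _ = refl

notC₂-one : ∀ {l} → side l ≡ one → notC₂ l ≡ true
notC₂-one {a₁} _ = refl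
notC₂-one {b₁} _ = refl
notC₂-one {c₁} _ = refl

pole-of : ∀ {l} → side l ≡ two → notC₂ l ≡ true → Σ Pole λ β → l ≡ lab₂ β
pole-of {a₂} _ _ = A , refl
pole-of {b₂} _ _ = B , refl

A₂B₂-path-parity : ∀ {V} {T : Trigraph V} {s : V → Lab} {p v L} → TwoJoinParity T s p →
  IsPathSeq T v L → s (v 0) ≡ a₂ → s (v L) ≡ b₂ → (∀ m → 0 < m → m < L → s (v m) ≡ c₂) →
  parity L ≡ p
A₂B₂-path-parity {T = T} TP Q v₀ v_L interior =
  TP two _ _ _ v₀ v_L (toPathOfLength T Q) (λ m → interior (toℕ m))

module TwoJoinPaths {V : Set} (T : Trigraph V) (s : V → Lab) (J : IsTwoJoin T s) where

  strongly-complete : ∀ α {x y} → s x ≡ lab₁ α → s y ≡ lab₂ α → θ T x y ≡ strong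
  strongly-complete A = IsTwoJoin.AA J _ _
  strongly-complete B = IsTwoJoin.BB J _ _

  crossing : ∀ {x y} → side (s x) ≡ one → side (s y) ≡ two → Adjacent T x y →
    Σ Pole λ α → s x ≡ lab₁ α × s y ≡ lab₂ α
  crossing {x} {y} x₁ y₂ x~y with θ T x y in θxy
  ... | anti   = contradiction refl x~y
  ... | semi   = contradiction θxy (IsTwoJoin.no-switch J x y x₁ y₂)
  ... | strong with IsTwoJoin.no-other J x y x₁ y₂ θxy
  ...   | inj₁ (xa , ya) = A , xa , ya
  ...   | inj₂ (xb , yb) = B , xb , yb

  c₂-neighbour-side : ∀ {x y} → Adjacent T x y → s y ≡ c₂ → side (s x) ≡ two
  c₂-neighbour-side {x} x~y y∈C₂ with side (s x) in sx
  ... | two = refl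
  ... | one with crossing sx (cong side y∈C₂) x~y
  ...   | α , _ , y∈lab₂ = contradiction (trans (sym y∈lab₂) y∈C₂) (lab₂≢c₂ α)

  c₂-neighbour : ∀ {x y} → Adjacent T x y → s y ≡ c₂ → notC₂ (s x) ≡ true →
    Σ Pole λ β → s x ≡ lab₂ β
  c₂-neighbour x~y y∈C₂ = pole-of (c₂-neighbour-side x~y y∈C₂)

  module OnPath {w : ℕ → V} {k : ℕ} (P : IsPathSeq T w k)
    (start₁ : side (s (w 0)) ≡ one) (end₁ : side (s (w k)) ≡ one) where

    distant-not-complete : ∀ α {m m'} → 2 + m ≤ m' → m' ≤ k →
      s (w m) ≡ lab₁ α → s (w m') ≡ lab₂ α → ⊥
    distant-not-complete α lt m'≤k wm wm' =
      antiadjacent P _ _ lt m'≤k (strongly-complete α wm wm')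

    distant-not-complete′ : ∀ α {m m'} → 2 + m ≤ m' → m' ≤ k →
      s (w m) ≡ lab₂ α → s (w m') ≡ lab₁ α → ⊥
    distant-not-complete′ α {m} {m'} lt m'≤k wm wm' =
      antiadjacent P _ _ lt m'≤k (trans (θ-sym T (w m) (w m')) (strongly-complete α wm' wm))

    private
      onSideOne : ℕ → Bool
      onSideOne m = isOne (side (s (w m)))

      notInC₂ : ℕ → Bool
      notInC₂ m = notC₂ (s (w m))

      onSideOne-pole : ∀ {m α} → s (w m) ≡ lab₂ α → onSideOne m ≡ false
      onSideOne-pole {α = α} e = cong isOne (pole-side α e)

    -- P leaves X₁ just before i and re-enters it just after j along crossing edges. Neither
    -- uses the pole α (its X₁-end would be strongly adjacent to w i or w j), so both use the
    -- other pole, and then their X₁-ends are strongly adjacent although far apart on P.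
    pole-unique< : ∀ α {i j} → i < j → j ≤ k → s (w i) ≡ lab₂ α → s (w j) ≡ lab₂ α → ⊥
    pole-unique< α {i} {j} i<j j≤k wi wj
      with lastTrueBelow onSideOne (cong isOne start₁) i (onSideOne-pole wi)
         | firstTrueAbove onSideOne (cong isOne end₁) j j≤k (onSideOne-pole wj)
    ... | t , t<i , qt , gapt | suc r , j<sr , sr≤k , qsr , gapr
      with crossing (isOne-true qt) (isOne-false (gapt (suc t) ≤-refl t<i))
                    (adjacent P t (<-≤-trans t<i (≤-trans (<⇒≤ i<j) j≤k)))
         | crossing (isOne-true qsr) (isOne-false (gapr r (s≤s⁻¹ j<sr) ≤-refl))
                    (adjacent-sym T (adjacent P r sr≤k))
    ... | α′ , wt , _ | α″ , wsr , wr = distant-not-complete α′ t+2≤r (≤-trans (n≤1+n r) sr≤k) wt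
          (trans wr (cong lab₂ (trans (≢⇒opposite α″≢α) (sym (≢⇒opposite α′≢α)))))
      where
      t+2≤r : 2 + t ≤ r
      t+2≤r = <-≤-trans (s≤s t<i) (≤-trans i<j (s≤s⁻¹ j<sr))
      α′≢α : α′ ≢ α
      α′≢α refl = distant-not-complete α (≤-trans (s≤s t<i) i<j) j≤k wt wj
      α″≢α : α″ ≢ α
      α″≢α refl = distant-not-complete′ α (≤-trans (s≤s i<j) j<sr) sr≤k wi wsr

    pole-unique : ∀ α {i j} → i ≤ k → j ≤ k → s (w i) ≡ lab₂ α → s (w j) ≡ lab₂ α → i ≡ j
    pole-unique α {i} {j} i≤k j≤k wi wj with <-cmp i j
    ... | tri< i<j _ _ = ⊥-elim (pole-unique< α i<j j≤k wi wj)
    ... | tri≈ _ i≡j _ = i≡j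
    ... | tri> _ _ j<i = ⊥-elim (pole-unique< α j<i i≤k wj wi)

    record C₂Run (i j : ℕ) (β : Pole) : Set where
      field
        i<j        : i < j
        j≤k        : j ≤ k
        start-pole : s (w i) ≡ lab₂ β
        end-pole   : s (w j) ≡ lab₂ (opposite β)
        interior   : ∀ m → i < m → m < j → s (w m) ≡ c₂

      i≤k : i ≤ k
      i≤k = ≤-trans (<⇒≤ i<j) j≤k

    c₂-run : ∀ {t} → t ≤ k → s (w t) ≡ c₂ →
      Σ ℕ λ i → Σ ℕ λ j → Σ Pole λ β → C₂Run i j β × i < t × t < j
    c₂-run {t} t≤k wt
      with lastTrueBelow notInC₂ (notC₂-one start₁) t (cong notC₂ wt)
         | firstTrueAbove notInC₂ (notC₂-one end₁) t t≤k (cong notC₂ wt)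
    ... | i , i<t , qi , gapi | suc r , t<sr , sr≤k , qsr , gapr
      with c₂-neighbour (adjacent P i (≤-trans i<t t≤k)) (notC₂-false (gapi (suc i) ≤-refl i<t)) qi
         | c₂-neighbour (adjacent-sym T (adjacent P r sr≤k))
                        (notC₂-false (gapr r (s≤s⁻¹ t<sr) ≤-refl)) qsr
    ... | β , wi | β′ , wsr = i , suc r , β , run , i<t , t<sr
      where
      β′≢β : β′ ≢ β
      β′≢β refl = <⇒≢ (<-trans i<t t<sr) (pole-unique β (≤-trans (<⇒≤ i<t) t≤k) sr≤k wi wsr)
      interior : ∀ m → i < m → m < suc r → s (w m) ≡ c₂
      interior m i<m m<sr with m ≤? t
      ... | yes m≤t = notC₂-false (gapi m i<m m≤t)
      ... | no  m≰t = notC₂-false (gapr m (<⇒≤ (≰⇒> m≰t)) m<sr)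
      run : C₂Run i (suc r) β
      run = record
        { i<j = <-trans i<t t<sr ; j≤k = sr≤k ; start-pole = wi
        ; end-pole = trans wsr (cong lab₂ (≢⇒opposite β′≢β)) ; interior = interior }

    run-ends : ∀ {i j β i′ j′ β′} → C₂Run i j β → C₂Run i′ j′ β′ →
      (i′ ≡ i × j′ ≡ j) ⊎ (i′ ≡ j × j′ ≡ i)
    run-ends {β = β} {β′ = β′} run run′ with β′ ≟ᴾ β
    ... | yes refl =
          inj₁ (pole-unique β (i≤k run′) (i≤k run) (start-pole run′) (start-pole run)
               , pole-unique (opposite β) (j≤k run′) (j≤k run) (end-pole run′) (end-pole run))
      where open C₂Run
    ... | no β′≢β with refl ← ≢⇒opposite β′≢β =
          inj₂ (pole-unique (opposite β) (i≤k run′) (j≤k run) (start-pole run′) (end-pole run)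
               , pole-unique β (j≤k run′) (i≤k run)
                   (trans (end-pole run′) (cong lab₂ (opposite-involutive β))) (start-pole run))
      where open C₂Run

    c₂-within-run : ∀ {i j β Q} → C₂Run i j β → Q ≤ k → s (w Q) ≡ c₂ → i < Q × Q < j
    c₂-within-run run Q≤k wQ with c₂-run Q≤k wQ
    ... | _ , _ , _ , run′ , i′<Q , Q<j′ with run-ends run run′
    ...   | inj₁ (refl , refl) = i′<Q , Q<j′
    ...   | inj₂ (refl , refl) = ⊥-elim (<⇒≱ (C₂Run.i<j run) (<⇒≤ (<-trans i′<Q Q<j′)))

    run-parity : ∀ {p i j β} → TwoJoinParity T s p → C₂Run i j β → parity (j ∸ i) ≡ p
    run-parity {p} {i} {j} {β} TP run = by-pole β (start-pole run) (end-pole run)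
      where
      open C₂Run
      L : ℕ
      L = j ∸ i
      i+L≡j : i + L ≡ j
      i+L≡j = m+[n∸m]≡n (<⇒≤ (i<j run))
      segment : IsPathSeq T (λ m → w (i + m)) L
      segment = restrict T i L (≤-trans (≤-reflexive i+L≡j) (j≤k run)) P
      at-i : ∀ {l} → s (w i) ≡ l → s (w (i + 0)) ≡ l
      at-i = subst (λ m → s (w m) ≡ _) (sym (+-identityʳ i))
      at-j : ∀ {l} → s (w j) ≡ l → s (w (i + L)) ≡ l
      at-j = subst (λ m → s (w m) ≡ _) (sym i+L≡j)
      by-pole : ∀ β → s (w i) ≡ lab₂ β → s (w j) ≡ lab₂ (opposite β) → parity L ≡ p
      by-pole A wi wj = A₂B₂-path-parity TP segment (at-i wi) (at-j wj)
        λ m 0<m m<L → interior run (i + m) (m<m+n i 0<m)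
                        (subst (i + m <_) i+L≡j (+-monoʳ-< i m<L))
      by-pole B wi wj = A₂B₂-path-parity TP (reverse T segment) (at-j wj)
        (subst (λ m → s (w (i + m)) ≡ b₂) (sym (n∸n≡0 L)) (at-i wi))
        λ m 0<m m<L → interior run (i + (L ∸ m)) (m<m+n i (m<n⇒0<n∸m m<L))
                        (subst (i + (L ∸ m) <_) i+L≡j
                          (+-monoʳ-< i (∸-monoʳ-< {o = 0} 0<m (<⇒≤ m<L))))

poleMarker : ∀ {p} → Pole → Marker p
poleMarker A = ma
poleMarker B = mb

-- In an odd 2-join no vertex of C₂ is kept on a shortened path, so the choice is immaterial.
innerMarker : (p : Bool) → Marker p
innerMarker true  = ma
innerMarker false = mc

poleMarker-injective : ∀ {p α β} → poleMarker {p} α ≡ poleMarker β → α ≡ β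
poleMarker-injective {α = A} {A} _ = refl
poleMarker-injective {α = B} {B} _ = refl

poleMarker≢innerMarker : ∀ {p} α → p ≡ false → poleMarker α ≢ innerMarker p
poleMarker≢innerMarker A refl ()
poleMarker≢innerMarker B refl ()

markerAdj-strong : ∀ {p} l α → markerAdj {p} l (poleMarker α) ≡ strong → l ≡ lab₁ α
markerAdj-strong a₁ A _ = refl
markerAdj-strong b₁ B _ = refl

markerAdj-pole : ∀ {p l} α → l ≡ lab₁ α → markerAdj {p} l (poleMarker α) ≡ strong
markerAdj-pole A refl = refl
markerAdj-pole B refl = refl

markerAdj-inner : ∀ {p} l → p ≡ false → markerAdj l (innerMarker p) ≡ anti
markerAdj-inner a₁ refl = refl
markerAdj-inner b₁ refl = refl
markerAdj-inner c₁ refl = refl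
markerAdj-inner a₂ refl = refl
markerAdj-inner b₂ refl = refl
markerAdj-inner c₂ refl = refl

mm-not-strong : ∀ {p} (m m' : Marker p) → mm m m' ≢ strong
mm-not-strong {true}  ma ma ()
mm-not-strong {true}  ma mb ()
mm-not-strong {true}  mb ma ()
mm-not-strong {true}  mb mb ()
mm-not-strong {false} ma ma ()
mm-not-strong {false} ma mb ()
mm-not-strong {false} ma mc ()
mm-not-strong {false} mb ma ()
mm-not-strong {false} mb mb ()
mm-not-strong {false} mb mc ()
mm-not-strong {false} mc ma ()
mm-not-strong {false} mc mb ()
mm-not-strong {false} mc mc ()

mm-opposite-poles : ∀ {p} α → p ≡ true → mm {p} (poleMarker α) (poleMarker (opposite α)) ≡ semi
mm-opposite-poles A refl = refl
mm-opposite-poles B refl = refl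

mm-pole-inner : ∀ {p} α → p ≡ false → mm {p} (poleMarker α) (innerMarker p) ≡ semi
mm-pole-inner A refl = refl
mm-pole-inner B refl = refl

mm-inner-pole : ∀ {p} α → p ≡ false → mm {p} (innerMarker p) (poleMarker α) ≡ semi
mm-inner-pole A refl = refl
mm-inner-pole B refl = refl

module ProjectionToBlock {V : Set} (T : Trigraph V) (s : V → Lab) (p : Bool)
  (J : IsTwoJoin T s) where
  open TwoJoinPaths T s J

  Tₓ : Trigraph (BlockV T s p)
  Tₓ = Block T s p

  projectAt : (x : V) (l : Lab) → s x ≡ l → BlockV T s p
  projectAt x a₁ e = inj₁ (x , cong side e)
  projectAt x b₁ e = inj₁ (x , cong side e)
  projectAt x c₁ e = inj₁ (x , cong side e)
  projectAt x a₂ _ = inj₂ (poleMarker A)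
  projectAt x b₂ _ = inj₂ (poleMarker B)
  projectAt x c₂ _ = inj₂ (innerMarker p)

  project : V → BlockV T s p
  project x = projectAt x (s x) refl

  data ProjectView (x : V) : Set where
    in-X₁   : (x₁ : side (s x) ≡ one) → project x ≡ inj₁ (x , x₁) → ProjectView x
    at-pole : ∀ α → s x ≡ lab₂ α → project x ≡ inj₂ (poleMarker α) → ProjectView x
    in-C₂   : s x ≡ c₂ → project x ≡ inj₂ (innerMarker p) → ProjectView x

  projectView : ∀ x → ProjectView x
  projectView x = view (s x) refl
    where
    project≡ : ∀ l (e : s x ≡ l) → project x ≡ projectAt x l e
    project≡ _ refl = refl
    view : ∀ l → s x ≡ l → ProjectView x
    view a₁ e = in-X₁ (cong side e) (project≡ a₁ e)
    view b₁ e = in-X₁ (cong side e) (project≡ b₁ e)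
    view c₁ e = in-X₁ (cong side e) (project≡ c₁ e)
    view a₂ e = at-pole A e (project≡ a₂ e)
    view b₂ e = at-pole B e (project≡ b₂ e)
    view c₂ e = in-C₂ e (project≡ c₂ e)

  project-X₁ : ∀ {x} (x₁ : side (s x) ≡ one) → project x ≡ inj₁ (x , x₁)
  project-X₁ {x} x₁ with projectView x
  ... | in-X₁ x₁′ e    = trans e (cong (λ q → inj₁ (x , q)) (uip x₁′ x₁))
  ... | at-pole α x∈ _ = contradiction (trans (sym x₁) (pole-side α x∈)) λ ()
  ... | in-C₂ x∈ _     = contradiction (trans (sym x₁) (cong side x∈)) λ ()

  project-adjacent₁ : ∀ {x y} → side (s x) ≡ one → Adjacent T x y →
    Adjacent Tₓ (project x) (project y)
  project-adjacent₁ {x} {y} x₁ x~y with projectView y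
  ... | in-X₁ _ ey = subst₂ (Adjacent Tₓ) (sym (project-X₁ x₁)) (sym ey) x~y
  ... | in-C₂ y∈ _ = contradiction (trans (sym x₁) (c₂-neighbour-side x~y y∈)) λ ()
  ... | at-pole α y∈ ey with crossing x₁ (pole-side α y∈) x~y
  ...   | β , x∈ , y∈′ = subst₂ (Adjacent Tₓ) (sym (project-X₁ x₁)) (sym ey)
          (strong⇒adjacent Tₓ {inj₁ (x , x₁)} {inj₂ (poleMarker α)}
            (markerAdj-pole α (trans x∈ (cong lab₁ (lab₂-injective (trans (sym y∈′) y∈))))))

  project-antiadjacent₁ : ∀ {x y} → side (s x) ≡ one → (s y ≡ c₂ → p ≡ false) →
    Antiadjacent T x y → Antiadjacent Tₓ (project x) (project y)
  project-antiadjacent₁ {x} {y} x₁ cy x≁y with projectView y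
  ... | in-X₁ _ ey = subst₂ (Antiadjacent Tₓ) (sym (project-X₁ x₁)) (sym ey) x≁y
  ... | at-pole α y∈ ey = subst₂ (Antiadjacent Tₓ) (sym (project-X₁ x₁)) (sym ey)
        λ e → x≁y (strongly-complete α (markerAdj-strong (s x) α e) y∈)
  ... | in-C₂ y∈ ey = subst₂ (Antiadjacent Tₓ) (sym (project-X₁ x₁)) (sym ey)
        (anti⇒antiadjacent Tₓ {inj₁ (x , x₁)} {inj₂ (innerMarker p)} (markerAdj-inner (s x) (cy y∈)))

  private
    markers-antiadjacent : ∀ {x y m m'} → project x ≡ inj₂ m → project y ≡ inj₂ m' →
      Antiadjacent Tₓ (project x) (project y)
    markers-antiadjacent ex ey = subst₂ (Antiadjacent Tₓ) (sym ex) (sym ey) (mm-not-strong _ _)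

    marker-≡ : ∀ {x y m m'} → project x ≡ project y → project x ≡ inj₂ m → project y ≡ inj₂ m' →
      m ≡ m'
    marker-≡ e ex ey = inj₂-injective (trans (sym ex) (trans e ey))

  project-antiadjacent : ∀ {x y} → (s x ≡ c₂ → p ≡ false) → (s y ≡ c₂ → p ≡ false) →
    Antiadjacent T x y → Antiadjacent Tₓ (project x) (project y)
  project-antiadjacent {x} {y} cx cy x≁y with projectView x | projectView y
  ... | in-X₁ x₁ _ | _ = project-antiadjacent₁ x₁ cy x≁y
  ... | _ | in-X₁ y₁ _ =
        antiadjacent-sym Tₓ {project y} (project-antiadjacent₁ y₁ cx (antiadjacent-sym T x≁y))
  ... | at-pole _ _ ex | at-pole _ _ ey = markers-antiadjacent ex ey
  ... | at-pole _ _ ex | in-C₂ _ ey     = markers-antiadjacent ex ey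
  ... | in-C₂ _ ex     | at-pole _ _ ey = markers-antiadjacent ex ey
  ... | in-C₂ _ ex     | in-C₂ _ ey     = markers-antiadjacent ex ey

  project-injective : ∀ {x y} → (s x ≡ c₂ → p ≡ false) → (s y ≡ c₂ → p ≡ false) →
    project x ≡ project y → x ≡ y ⊎ (side (s x) ≡ two × s x ≡ s y)
  project-injective {x} {y} cx cy e with projectView x | projectView y
  ... | in-X₁ _ ex | in-X₁ _ ey = inj₁ (cong proj₁ (inj₁-injective (trans (sym ex) (trans e ey))))
  ... | in-X₁ _ ex | at-pole _ _ ey with () ← trans (sym ex) (trans e ey)
  ... | in-X₁ _ ex | in-C₂ _ ey     with () ← trans (sym ex) (trans e ey)
  ... | at-pole _ _ ex | in-X₁ _ ey with () ← trans (sym ex) (trans e ey)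
  ... | in-C₂ _ ex     | in-X₁ _ ey with () ← trans (sym ex) (trans e ey)
  ... | at-pole α x∈ ex | at-pole β y∈ ey = inj₂ (pole-side α x∈ ,
        trans x∈ (trans (cong lab₂ (poleMarker-injective (marker-≡ e ex ey))) (sym y∈)))
  ... | at-pole α _ ex | in-C₂ y∈ ey =
        contradiction (marker-≡ e ex ey) (poleMarker≢innerMarker α (cy y∈))
  ... | in-C₂ x∈ ex | at-pole α _ ey =
        contradiction (sym (marker-≡ e ex ey)) (poleMarker≢innerMarker α (cx x∈))
  ... | in-C₂ x∈ _ | in-C₂ y∈ _ = inj₂ (cong side x∈ , trans x∈ (sym y∈))

  project-adjacent₂ : ∀ {x y} → side (s x) ≡ two → side (s y) ≡ two → s x ≢ s y →
    (s x ≡ c₂ → p ≡ false) → (s y ≡ c₂ → p ≡ false) →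
    (∀ β → s x ≡ lab₂ β → s y ≡ lab₂ (opposite β) → p ≡ true) →
    Adjacent Tₓ (project x) (project y)
  project-adjacent₂ {x} {y} x₂ y₂ sx≢sy cx cy poles with projectView x | projectView y
  ... | in-X₁ x₁ _ | _ = contradiction (trans (sym x₁) x₂) λ ()
  ... | _ | in-X₁ y₁ _ = contradiction (trans (sym y₁) y₂) λ ()
  ... | at-pole α x∈ ex | at-pole β y∈ ey = subst₂ (Adjacent Tₓ) (sym ex) (sym ey)
        (subst (λ γ → mm (poleMarker α) (poleMarker γ) ≢ anti) (sym β≡opposite)
          (semi⇒adjacent Tₓ {inj₂ (poleMarker α)} {inj₂ (poleMarker (opposite α))}
            (mm-opposite-poles α (poles α x∈ (trans y∈ (cong lab₂ β≡opposite))))))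
    where
    β≡opposite : β ≡ opposite α
    β≡opposite = ≢⇒opposite λ β≡α → sx≢sy (trans x∈ (trans (cong lab₂ (sym β≡α)) (sym y∈)))
  ... | at-pole α _ ex | in-C₂ y∈ ey = subst₂ (Adjacent Tₓ) (sym ex) (sym ey)
        (semi⇒adjacent Tₓ {inj₂ (poleMarker α)} {inj₂ (innerMarker p)} (mm-pole-inner α (cy y∈)))
  ... | in-C₂ x∈ ex | at-pole α _ ey = subst₂ (Adjacent Tₓ) (sym ex) (sym ey)
        (semi⇒adjacent Tₓ {inj₂ (innerMarker p)} {inj₂ (poleMarker α)} (mm-inner-pole α (cx x∈)))
  ... | in-C₂ x∈ _ | in-C₂ y∈ _ = contradiction (trans x∈ (sym y∈)) sx≢sy

-- Shortening a path into the block

parity-+ : ∀ m n → parity (m + n) ≡ parity m xor parity n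
parity-+ zero    n = refl
parity-+ (suc m) n = trans (cong not (parity-+ m n)) (not-distribˡ-xor (parity m) (parity n))

2+i+e∸i : ∀ i e → 2 + i + e ∸ i ≡ 2 + e
2+i+e∸i i e = trans (+-∸-assoc 2 (m≤m+n i e)) (cong (2 +_) (m+n∸m≡n i e))

module Shortcuts {V : Set} (T : Trigraph V) (s : V → Lab) (p : Bool) (J : IsTwoJoin T s)
  (TP : TwoJoinParity T s p) {w : ℕ → V} {k : ℕ} (P : IsPathSeq T w k)
  (start₁ : side (s (w 0)) ≡ one) (end₁ : side (s (w k)) ≡ one) where

  open TwoJoinPaths T s J
  open OnPath P start₁ end₁
  open ProjectionToBlock T s p J

  record Shortcut (m₀ d : ℕ) : Set where
    field
      even-length : parity d ≡ false
      within      : m₀ + d ≤ k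
      last-kept   : d ≡ 0 ⊎ m₀ + d < k
      kept-C₂     : ∀ Q → Q ≤ k → OutsideWindow m₀ d Q → s (w Q) ≡ c₂ → p ≡ false × Q ≡ m₀
      across      : 0 < d → Adjacent Tₓ (project (w m₀)) (project (w (suc (m₀ + d))))

  module _ {m₀ d : ℕ} (S : Shortcut m₀ d) where
    open Shortcut S

    private
      Kept : ℕ → Set
      Kept = OutsideWindow m₀ d

      c₂-kept : ∀ {Q} → Q ≤ k → Kept Q → s (w Q) ≡ c₂ → p ≡ false
      c₂-kept Q≤k out wQ = proj₁ (kept-C₂ _ Q≤k out wQ)

      same-label : ∀ {Q Q'} → Q ≤ k → Q' ≤ k → Kept Q → Kept Q' →
        side (s (w Q)) ≡ two → s (w Q) ≡ s (w Q') → Q ≡ Q'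
      same-label {Q} {Q'} Q≤k Q'≤k out out' Q₂ same with s (w Q) in wQ
      ... | a₂ = pole-unique A Q≤k Q'≤k wQ (sym same)
      ... | b₂ = pole-unique B Q≤k Q'≤k wQ (sym same)
      ... | c₂ = trans (proj₂ (kept-C₂ Q Q≤k out wQ)) (sym (proj₂ (kept-C₂ Q' Q'≤k out' (sym same))))

      consecutive : ∀ Q → Q < k → Kept Q → Kept (suc Q) →
        Adjacent Tₓ (project (w Q)) (project (w (suc Q)))
      consecutive Q Q<k out out' with side (s (w Q)) in Q₁ | side (s (w (suc Q))) in sQ₁
      ... | one | _   = project-adjacent₁ Q₁ (adjacent P Q Q<k)
      ... | two | one = adjacent-sym Tₓ {project (w (suc Q))}
                          (project-adjacent₁ sQ₁ (adjacent-sym T (adjacent P Q Q<k)))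
      ... | two | two = project-adjacent₂ Q₁ sQ₁
          (λ same → <⇒≢ (n<1+n Q) (same-label (<⇒≤ Q<k) Q<k out out' Q₁ same))
          (c₂-kept (<⇒≤ Q<k) out) (c₂-kept Q<k out')
          λ β wQ wsQ → trans (sym (run-parity TP (record
            { i<j = n<1+n Q ; j≤k = Q<k ; start-pole = wQ ; end-pole = wsQ
            ; interior = λ m Q<m m<sQ → contradiction (s≤s⁻¹ m<sQ) (<⇒≱ Q<m) })))
            (cong parity (suc-∸ Q))
        where
        suc-∸ : ∀ n → suc n ∸ n ≡ 1
        suc-∸ n = trans (+-∸-assoc 1 (≤-refl {n})) (cong suc (n∸n≡0 n))

      injective-kept : ∀ Q Q' → Kept Q → Kept Q' → Q ≤ k → Q' ≤ k →
        project (w Q) ≡ project (w Q') → Q ≡ Q'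
      injective-kept Q Q' out out' Q≤k Q'≤k e
        with project-injective (c₂-kept Q≤k out) (c₂-kept Q'≤k out') e
      ... | inj₁ wQ≡wQ'      = injective P Q Q' Q≤k Q'≤k wQ≡wQ'
      ... | inj₂ (Q₂ , same) = same-label Q≤k Q'≤k out out' Q₂ same

    shortcut-path : IsPathSeq Tₓ (project ∘ w ∘ skipWindow m₀ d) (k ∸ d)
    shortcut-path = deleteWindow Tₓ (project ∘ w) within consecutive across
      (λ Q Q' out out' lt Q'≤k → project-antiadjacent
         (c₂-kept (≤-trans (m≤n+m Q 2) (≤-trans lt Q'≤k)) out) (c₂-kept Q'≤k out')
         (antiadjacent P Q Q' lt Q'≤k))
      injective-kept

  no-C₂-shortcut : (∀ t → t ≤ k → s (w t) ≢ c₂) → Shortcut k 0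
  no-C₂-shortcut no-C₂ = record
    { even-length = refl
    ; within      = ≤-reflexive (+-identityʳ k)
    ; last-kept   = inj₁ refl
    ; kept-C₂     = λ Q Q≤k _ wQ → contradiction wQ (no-C₂ Q Q≤k)
    ; across      = λ () }

  -- The run A₂ C₂ … C₂ B₂ keeps only its ends when the 2-join is odd, and its ends and first
  -- C₂-vertex when it is even; either way an even number of vertices is removed.
  odd-run-shortcut : ∀ {i e β} → p ≡ true → C₂Run i (2 + i + e) β → Shortcut i (suc e)
  odd-run-shortcut {i} {e} {β} p≡ run = record
    { even-length = trans (sym (not-involutive _)) (cong not run-parity′)
    ; within      = ≤-trans (≤-reflexive (+-suc i e)) (<⇒≤ j≤k)
    ; last-kept   = inj₂ (≤-trans (≤-reflexive (cong suc (+-suc i e))) j≤k)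
    ; kept-C₂     = λ Q Q≤k out wQ → ⊥-elim (C₂-inside Q≤k wQ out)
    ; across      = λ _ → subst (λ j → Adjacent Tₓ (project (w i)) (project (w j)))
        (cong suc (sym (+-suc i e)))
        (project-adjacent₂ (pole-side β start-pole) (pole-side (opposite β) end-pole)
          (λ same → opposite-≢ β (lab₂-injective (trans (sym end-pole) (trans (sym same) start-pole))))
          (λ c → contradiction (trans (sym start-pole) c) (lab₂≢c₂ β))
          (λ c → contradiction (trans (sym end-pole) c) (lab₂≢c₂ (opposite β)))
          λ _ _ _ → p≡) }
    where
    open C₂Run run
    run-parity′ : parity (2 + e) ≡ true
    run-parity′ = trans (cong parity (sym (2+i+e∸i i e))) (trans (run-parity TP run) p≡)
    C₂-inside : ∀ {Q} → Q ≤ k → s (w Q) ≡ c₂ → ¬ OutsideWindow i (suc e) Q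
    C₂-inside Q≤k wQ out with c₂-within-run run Q≤k wQ | out
    ... | i<Q , _   | inj₁ Q≤i  = <⇒≱ i<Q Q≤i
    ... | _   , Q<j | inj₂ i+e<Q = <⇒≱ Q<j (≤-trans (≤-reflexive (cong suc (sym (+-suc i e)))) i+e<Q)

  even-run-shortcut : ∀ {i e β} → p ≡ false → C₂Run i (2 + i + e) β → Shortcut (suc i) e
  even-run-shortcut {i} {e} {β} p≡ run = record
    { even-length = trans (sym (not-involutive _)) run-parity′
    ; within      = <⇒≤ j≤k
    ; last-kept   = inj₂ j≤k
    ; kept-C₂     = λ Q Q≤k out wQ → p≡ , only-C₂ Q≤k wQ out
    ; across      = λ _ → project-adjacent₂ (cong side first-C₂) (pole-side (opposite β) end-pole)
          (λ same → lab₂≢c₂ (opposite β) (trans (sym end-pole) (trans (sym same) first-C₂)))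
          (λ _ → p≡)
          (λ c → contradiction (trans (sym end-pole) c) (lab₂≢c₂ (opposite β)))
          (λ β′ x∈ _ → contradiction (trans (sym x∈) first-C₂) (lab₂≢c₂ β′)) }
    where
    open C₂Run run
    run-parity′ : parity (2 + e) ≡ false
    run-parity′ = trans (cong parity (sym (2+i+e∸i i e))) (trans (run-parity TP run) p≡)
    first-C₂ : s (w (suc i)) ≡ c₂
    first-C₂ = interior (suc i) ≤-refl (s≤s (s≤s (m≤m+n i e)))
    only-C₂ : ∀ {Q} → Q ≤ k → s (w Q) ≡ c₂ → OutsideWindow (suc i) e Q → Q ≡ suc i
    only-C₂ Q≤k wQ out with c₂-within-run run Q≤k wQ | out
    ... | i<Q , _   | inj₁ Q≤si  = ≤-antisym Q≤si i<Q
    ... | _   , Q<j | inj₂ i+e<Q = contradiction i+e<Q (<⇒≱ Q<j)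

  shortcut-exists : Σ ℕ λ m₀ → Σ ℕ λ d → Shortcut m₀ d
  shortcut-exists with anyUpTo? (λ t → notC₂ (s (w t)) ≟ᵇ false) (suc k)
  ... | no ∄C₂ = k , 0 , no-C₂-shortcut λ t t≤k wt → ∄C₂ (t , s≤s t≤k , cong notC₂ wt)
  ... | yes (t , t<sk , qt) with c₂-run (s≤s⁻¹ t<sk) (notC₂-false qt)
  ...   | i , j , β , run , i<t , t<j with m≤n⇒∃[o]m+o≡n (≤-trans (s≤s i<t) t<j)
  ...     | e , refl with p ≟ᵇ true
  ...       | yes p≡true = i , suc e , odd-run-shortcut p≡true run
  ...       | no  p≢true = suc i , e , even-run-shortcut (¬-not p≢true) run

  parity-from-block :
    (∀ k′ → PathOfLength Tₓ k′ (project (w 0)) (project (w k)) → parity k′ ≡ false) →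
    parity k ≡ false
  parity-from-block even-in-block with shortcut-exists
  ... | m₀ , d , S = begin
      parity k                     ≡⟨ cong parity (sym (m∸n+n≡m d≤k)) ⟩
      parity (k ∸ d + d)           ≡⟨ parity-+ (k ∸ d) d ⟩
      parity (k ∸ d) xor parity d  ≡⟨ cong₂ _xor_ (even-in-block (k ∸ d) block-path)
                                                  (Shortcut.even-length S) ⟩
      false                        ∎
    where
    open ≡-Reasoning
    d≤k : d ≤ k
    d≤k = ≤-trans (m≤n+m d m₀) (Shortcut.within S)
    block-path : PathOfLength Tₓ (k ∸ d) (project (w 0)) (project (w k))
    block-path = subst₂ (λ a b → PathOfLength Tₓ (k ∸ d) (project (w a)) (project (w b)))
      (skipWindow-zero m₀ d) (skipWindow-last m₀ d (Shortcut.within S) (Shortcut.last-kept S))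
      (toPathOfLength Tₓ (shortcut-path S))

-- Berge-ness and properness are what make the parity of the 2-join well defined in the
-- paper; here that parity is the hypothesis TwoJoinParity.
theorem5p3 : ∀ {n : ℕ} (T : Trigraph (Fin n)) (s : Fin n → Lab) (p : Bool) →
    Berge T → IsTwoJoin T s → IsProper T s → TwoJoinParity T s p →
    (u v : Fin n) (hu : side (s u) ≡ one) (hv : side (s v) ≡ one) →
    EvenPair (Block T s p) (inj₁ (u , hu)) (inj₁ (v , hv)) →
    EvenPair T u v
theorem5p3 T s p _ J _ TP u v hu hv (u≢v , θuv , even-in-block) =
  u≢v ∘ same-in-block , θuv , even-paths
  where
  open ProjectionToBlock T s p J

  same-in-block : u ≡ v → inj₁ (u , hu) ≡ inj₁ (v , hv)
  same-in-block refl = trans (sym (project-X₁ hu)) (project-X₁ hv)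

  even-paths : ∀ k → PathOfLength T k u v → parity k ≡ false
  even-paths k P with fromPathOfLength T P
  ... | w , seq , w₀≡u , w_k≡v = Shortcuts.parity-from-block T s p J TP seq
    (subst (λ x → side (s x) ≡ one) (sym w₀≡u) hu) (subst (λ x → side (s x) ≡ one) (sym w_k≡v) hv)
    λ k′ Q → even-in-block k′ (subst₂ (PathOfLength Tₓ k′)
      (trans (cong project w₀≡u) (project-X₁ hu)) (trans (cong project w_k≡v) (project-X₁ hv)) Q)
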